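{- Let $M$ be a nested matroid on a ground set $E=\{e_1,\ldots,e_n\}$ and, for $i\in\{0,\ldots,n\}$, let $E_i=\{e_1,\ldots,e_i\}$. Then the number of minors of $M$ on $E\setminus E_i$ is at most $2^{\lambda_M(E_i)}$.
   Context: A matroid $M$ on $E$ is transversal if there are subsets $A_1,\ldots,A_m\subseteq E$ (a presentation) such that $I\subseteq E$ is independent iff there is an injection $\varphi\colon I\to\{1,\ldots,m\}$ with $e\in A_{\varphi(e)}$ for all $e\in I$; it is nested if it has such a presentation with $A_1\subseteq\cdots\subseteq A_m$. $r_M$ is the rank function, $r(M)=r_M(E)$, and $\lambda_M(X)=r_M(X)+r_M(E\setminus X)-r(M)$. For disjoint $X,Y\subseteq E$, $M\setminus X/Y$ is the matroid obtained by deleting $X$ and contracting $Y$. The minors of $M$ on $E\setminus E_i$ are the matroids $M\setminus(E_i\setminus Y)/Y$ for $Y\subseteq E_i$; their number is the number of distinct such matroids. -}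

module Defs where

open import Data.Nat using (ℕ; _<_; _<ᵇ_; _+_; _∸_; _^_; _≤_)
open import Data.Fin using (Fin; toℕ) renaming (_≤_ to _≤ᶠ_)
open import Data.Fin.Subset using (Subset; _∈_; _∉_; _⊆_; _∪_; ⁅_⁆; ∣_∣; ⊥; ⊤; ∁)
open import Data.Vec using (tabulate)
open import Data.List using (List; length)
open import Data.List.Membership.Propositional using () renaming (_∈_ to _∈ˡ_)
open import Data.Product using (Σ; ∃; _×_; _,_)
open import Data.Empty using () renaming (⊥ to Empty)
open import Function.Bundles using (_⇔_)
open import Relation.Binary.PropositionalEquality using (_≡_)
open import Relation.Nullary using (¬_)

-- A matroid on the ground set E = Fin n (element e_{k+1} is the index k),
-- given by its independent sets (axioms I1–I3).
record Matroid (n : ℕ) : Set₁ where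
  field
    Indep      : Subset n → Set
    indep-∅    : Indep ⊥
    indep-⊆    : ∀ {I J} → J ⊆ I → Indep I → Indep J
    indep-aug  : ∀ {I J} → Indep I → Indep J → ∣ I ∣ < ∣ J ∣ →
                 ∃ λ x → x ∈ J × x ∉ I × Indep (⁅ x ⁆ ∪ I)
open Matroid public

TransIndep : ∀ {n m} → (Fin m → Subset n) → Subset n → Set
TransIndep {n} {m} A I =
  Σ (Fin n → Fin m) λ φ →
    (∀ x y → x ∈ I → y ∈ I → φ x ≡ φ y → x ≡ y) ×
    (∀ x → x ∈ I → x ∈ A (φ x))

IsNested : ∀ {n} → Matroid n → Set
IsNested {n} M =
  Σ ℕ λ m → Σ (Fin m → Subset n) λ A →
    (∀ j k → j ≤ᶠ k → A j ⊆ A k) ×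
    (∀ I → Indep M I ⇔ TransIndep A I)

IsBasis : ∀ {n} → Matroid n → Subset n → Subset n → Set
IsBasis M X B =
  B ⊆ X × Indep M B × (∀ J → B ⊆ J → J ⊆ X → Indep M J → J ⊆ B)

IsRank : ∀ {n} → Matroid n → Subset n → ℕ → Set
IsRank M X k =
  (∃ λ I → I ⊆ X × Indep M I × ∣ I ∣ ≡ k) ×
  (∀ I → I ⊆ X → Indep M I → ∣ I ∣ ≤ k)

Epref : (n i : ℕ) → Subset n
Epref n i = tabulate (λ x → toℕ x <ᵇ i)

-- Independence in the minor M \ (E_i ∖ Y) / Y (for Y ⊆ E_i), a matroid on
-- E ∖ E_i: I ⊆ E ∖ E_i is independent iff I ∪ B is independent in M for a
-- basis B of Y.
MinorIndep : ∀ {n} → Matroid n → Subset n → Subset n → Set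
MinorIndep M Y I = ∃ λ B → IsBasis M Y B × Indep M (I ∪ B)

SameMinor : ∀ {n} → Matroid n → ℕ → Subset n → Subset n → Set
SameMinor {n} M i Y Y' =
  ∀ I → I ⊆ ∁ (Epref n i) → (MinorIndep M Y I ⇔ MinorIndep M Y' I)

-- "The number of minors of M on E ∖ E_i is at most k": there are at most k
-- choices Y ⊆ E_i such that every minor M \ (E_i ∖ Y) / Y equals one of them.
MinorCountAtMost : ∀ {n} → Matroid n → ℕ → ℕ → Set
MinorCountAtMost {n} M i k =
  Σ (List (Subset n)) λ L →
    length L ≤ k ×
    (∀ Y → Y ∈ˡ L → Y ⊆ Epref n i) ×
    (∀ Y → Y ⊆ Epref n i → ∃ λ Y' → Y' ∈ˡ L × SameMinor M i Y Y')

-- A nested presentation A₀ ⊆ ⋯ ⊆ Aₘ₋₁ is determined by the level of each element (the first j with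
-- e ∈ Aⱼ), and Hall's condition becomes: I is independent iff for every t ≤ m at most m − t elements
-- of I have level ≥ t.  This yields the rank formula r(S) = min_{u ≤ m} (m − u + #{e ∈ S : level e < u}),
-- from which r is submodular.
--
-- Let X = E_i, Z = E ∖ X and Z_t = {e ∈ Z : level e ≥ t}.  For Y ⊆ X, a set I ⊆ Z is independent in
-- M \ (X ∖ Y) / Y iff |I ∩ Z_t| ≤ ρ_Y(t) − r(Y) for all t, where ρ_Y(t) = r(Y ∪ Z_t) and ρ_Y(m) = r(Y).
-- So the minor is determined by the decrements d_Y(t) = ρ_Y(t) − ρ_Y(t+1), and submodularity gives
-- d_X(t) ≤ d_Y(t) ≤ d_∅(t).  Hence there are at most ∏ (1 + d_∅(t) − d_X(t)) ≤ 2^(Σ d_∅ − Σ d_X)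
-- minors, and the sums telescope: Σ d_∅ = ρ_∅(0) ≤ r(Z) and Σ d_X = ρ_X(0) − r(X) ≥ r(E) − r(X).

module Submission where

open import Defs
open import Data.Nat
open import Data.Nat.Properties
open import Data.Nat.Induction using (<-wellFounded)
open import Algebra.Properties.Monoid.Sum +-0-monoid using (sum; sum-syntax)
import Algebra.Properties.CommutativeSemigroup +-commutativeSemigroup as +-CS
import Algebra.Properties.CommutativeSemigroup *-commutativeSemigroup as *-CS
open import Data.Fin using (Fin; zero; suc; toℕ; fromℕ<) renaming (_≤_ to _≤ᶠ_)
open import Data.Fin.Properties using (any?; toℕ-fromℕ<; toℕ-injective)
  renaming (suc-injective to sucᶠ-injective; 0≢1+n to 0ᶠ≢1+n; _≟_ to _≟ᶠ_)
open import Data.Fin.Subset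
open import Data.Fin.Subset.Properties
open import Data.Fin.Subset.Induction using (⊃-wellFounded)
open import Data.Vec using (Vec; []; _∷_; here; there; tabulate; lookup)
open import Data.Vec.Properties using (lookup∘tabulate; lookup⇒[]=; []=⇒lookup; tabulate-cong; ≡-dec)
import Data.List as List
open import Data.List using (List; [_]; _++_; upTo; applyUpTo; cartesianProductWith; length; map)
open import Data.List.Properties using (length-++; length-map; length-applyUpTo)
open import Data.List.Membership.Propositional using () renaming (_∈_ to _∈ˡ_)
open import Data.List.Membership.Propositional.Properties
  using (∈-upTo⁺; ∈-upTo⁻; ∈-applyUpTo⁺; ∈-cartesianProductWith⁺; ∈-map⁺; ∈-map⁻)
open import Data.List.Relation.Unary.All as All using ()
open import Data.List.Relation.Unary.Any using () renaming (here to hereˡ)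
open import Data.List.Extrema ≤-totalOrder using (argmin; argmin-sel; f[argmin]≤f[⊤]; f[argmin]≤f[xs])
open import Data.Product using (Σ; ∃; _×_; _,_; proj₁; proj₂)
open import Data.Sum using (_⊎_; inj₁; inj₂)
open import Function using (_∘_)
open import Function.Bundles using (_⇔_; mk⇔; Equivalence)
open import Induction.WellFounded using (Acc; acc)
open import Relation.Nullary using (¬_; Dec; yes; no; does; contradiction; ¬?; _×-dec_; _⊎-dec_)
open import Relation.Nullary.Decidable using (dec-true; does-⇔)
open import Relation.Unary using (Decidable)
open import Relation.Binary.Definitions using (tri<; tri≈; tri>)
open import Relation.Binary.PropositionalEquality
  using (_≡_; _≢_; refl; sym; trans; cong; cong₂; subst; subst₂; module ≡-Reasoning)

∣p∪q∣+∣p∩q∣≡∣p∣+∣q∣ : ∀ {n} (p q : Subset n) → ∣ p ∪ q ∣ + ∣ p ∩ q ∣ ≡ ∣ p ∣ + ∣ q ∣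
∣p∪q∣+∣p∩q∣≡∣p∣+∣q∣ []            []            = refl
∣p∪q∣+∣p∩q∣≡∣p∣+∣q∣ (inside ∷ p)  (inside ∷ q)  = cong suc (begin
  ∣ p ∪ q ∣ + suc ∣ p ∩ q ∣     ≡⟨ +-suc ∣ p ∪ q ∣ ∣ p ∩ q ∣ ⟩
  suc (∣ p ∪ q ∣ + ∣ p ∩ q ∣)   ≡⟨ cong suc (∣p∪q∣+∣p∩q∣≡∣p∣+∣q∣ p q) ⟩
  suc (∣ p ∣ + ∣ q ∣)           ≡⟨ +-suc ∣ p ∣ ∣ q ∣ ⟨
  ∣ p ∣ + suc ∣ q ∣             ∎)
  where open ≡-Reasoning
∣p∪q∣+∣p∩q∣≡∣p∣+∣q∣ (inside ∷ p)  (outside ∷ q) = cong suc (∣p∪q∣+∣p∩q∣≡∣p∣+∣q∣ p q)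
∣p∪q∣+∣p∩q∣≡∣p∣+∣q∣ (outside ∷ p) (inside ∷ q)  =
  trans (cong suc (∣p∪q∣+∣p∩q∣≡∣p∣+∣q∣ p q)) (sym (+-suc ∣ p ∣ ∣ q ∣))
∣p∪q∣+∣p∩q∣≡∣p∣+∣q∣ (outside ∷ p) (outside ∷ q) = ∣p∪q∣+∣p∩q∣≡∣p∣+∣q∣ p q

∣p∩q∣+∣p∩∁q∣≡∣p∣ : ∀ {n} (p q : Subset n) → ∣ p ∩ q ∣ + ∣ p ∩ ∁ q ∣ ≡ ∣ p ∣
∣p∩q∣+∣p∩∁q∣≡∣p∣ []            []            = refl
∣p∩q∣+∣p∩∁q∣≡∣p∣ (inside ∷ p)  (inside ∷ q)  = cong suc (∣p∩q∣+∣p∩∁q∣≡∣p∣ p q)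
∣p∩q∣+∣p∩∁q∣≡∣p∣ (inside ∷ p)  (outside ∷ q) =
  trans (+-suc ∣ p ∩ q ∣ ∣ p ∩ ∁ q ∣) (cong suc (∣p∩q∣+∣p∩∁q∣≡∣p∣ p q))
∣p∩q∣+∣p∩∁q∣≡∣p∣ (outside ∷ p) (_ ∷ q)       = ∣p∩q∣+∣p∩∁q∣≡∣p∣ p q

∣p∪q∣≤∣p∣+∣q∣ : ∀ {n} (p q : Subset n) → ∣ p ∪ q ∣ ≤ ∣ p ∣ + ∣ q ∣
∣p∪q∣≤∣p∣+∣q∣ p q = ≤-trans (m≤m+n _ _) (≤-reflexive (∣p∪q∣+∣p∩q∣≡∣p∣+∣q∣ p q))

∣p∪q∣≡∣p∣+∣q∣ : ∀ {n} {p q : Subset n} → Empty (p ∩ q) → ∣ p ∪ q ∣ ≡ ∣ p ∣ + ∣ q ∣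
∣p∪q∣≡∣p∣+∣q∣ {n} {p} {q} disjoint = begin
  ∣ p ∪ q ∣                 ≡⟨ +-identityʳ _ ⟨
  ∣ p ∪ q ∣ + 0             ≡⟨ cong (∣ p ∪ q ∣ +_) (∣⊥∣≡0 n) ⟨
  ∣ p ∪ q ∣ + ∣ ⊥ {n} ∣     ≡⟨ cong (λ r → ∣ p ∪ q ∣ + ∣ r ∣) (Empty-unique disjoint) ⟨
  ∣ p ∪ q ∣ + ∣ p ∩ q ∣     ≡⟨ ∣p∪q∣+∣p∩q∣≡∣p∣+∣q∣ p q ⟩
  ∣ p ∣ + ∣ q ∣             ∎
  where open ≡-Reasoning

∣p∣+∣q∣-mono : ∀ {n} {p q r s : Subset n} → p ∪ q ⊆ r ∪ s → p ∩ q ⊆ r ∩ s →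
               ∣ p ∣ + ∣ q ∣ ≤ ∣ r ∣ + ∣ s ∣
∣p∣+∣q∣-mono {p = p} {q} {r} {s} ∪⊆ ∩⊆ = begin
  ∣ p ∣ + ∣ q ∣         ≡⟨ ∣p∪q∣+∣p∩q∣≡∣p∣+∣q∣ p q ⟨
  ∣ p ∪ q ∣ + ∣ p ∩ q ∣ ≤⟨ +-mono-≤ (p⊆q⇒∣p∣≤∣q∣ ∪⊆) (p⊆q⇒∣p∣≤∣q∣ ∩⊆) ⟩
  ∣ r ∪ s ∣ + ∣ r ∩ s ∣ ≡⟨ ∣p∪q∣+∣p∩q∣≡∣p∣+∣q∣ r s ⟩
  ∣ r ∣ + ∣ s ∣         ∎
  where open ≤-Reasoning

p⊆q⇒∣q∣≤∣p∣⇒q⊆p : ∀ {n} {p q : Subset n} → p ⊆ q → ∣ q ∣ ≤ ∣ p ∣ → q ⊆ p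
p⊆q⇒∣q∣≤∣p∣⇒q⊆p {p = p} p⊆q ∣q∣≤∣p∣ {x} x∈q with x ∈? p
... | yes x∈p = x∈p
... | no  x∉p = contradiction (p⊂q⇒∣p∣<∣q∣ (p⊆q , x , x∈q , x∉p)) (≤⇒≯ ∣q∣≤∣p∣)

injectiveOn⇒∣p∣≤∣q∣ : ∀ {n m} {p : Subset n} {q : Subset m} (φ : Fin n → Fin m) →
                      (∀ {x} → x ∈ p → φ x ∈ q) →
                      (∀ {x y} → x ∈ p → y ∈ p → φ x ≡ φ y → x ≡ y) →
                      ∣ p ∣ ≤ ∣ q ∣
injectiveOn⇒∣p∣≤∣q∣ {p = []}               φ into inj = z≤n
injectiveOn⇒∣p∣≤∣q∣ {p = outside ∷ p}      φ into inj =
  injectiveOn⇒∣p∣≤∣q∣ (φ ∘ suc) (into ∘ there) (λ x y e → sucᶠ-injective (inj (there x) (there y) e))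
injectiveOn⇒∣p∣≤∣q∣ {p = inside ∷ p} {q} φ into inj =
  ≤-trans (s≤s (injectiveOn⇒∣p∣≤∣q∣ (φ ∘ suc) into′ inj′)) (x∈p⇒∣p-x∣<∣p∣ (into here))
  where
  into′ : ∀ {x} → x ∈ p → φ (suc x) ∈ q - φ zero
  into′ x∈p = x∈p∧x≢y⇒x∈p-y (into (there x∈p)) (λ e → 0ᶠ≢1+n (inj here (there x∈p) (sym e)))
  inj′ : ∀ {x y} → x ∈ p → y ∈ p → φ (suc x) ≡ φ (suc y) → x ≡ y
  inj′ x∈p y∈p e = sucᶠ-injective (inj (there x∈p) (there y∈p) e)

∣[p∪q]∩r∣+∣[p∩q]∩s∣≤∣p∩r∣+∣q∩s∣ : ∀ {n} (p q : Subset n) {r s : Subset n} → r ⊆ s →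
                                 ∣ (p ∪ q) ∩ r ∣ + ∣ (p ∩ q) ∩ s ∣ ≤ ∣ p ∩ r ∣ + ∣ q ∩ s ∣
∣[p∪q]∩r∣+∣[p∩q]∩s∣≤∣p∩r∣+∣q∩s∣ p q {r} {s} r⊆s = ∣p∣+∣q∣-mono ∪⊆ ∩⊆
  where
  ∪⊆ : ((p ∪ q) ∩ r) ∪ ((p ∩ q) ∩ s) ⊆ (p ∩ r) ∪ (q ∩ s)
  ∪⊆ x∈ with x∈p∪q⁻ ((p ∪ q) ∩ r) _ x∈
  ... | inj₁ x∈[p∪q]∩r with x∈p∩q⁻ (p ∪ q) r x∈[p∪q]∩r
  ...   | x∈p∪q , x∈r with x∈p∪q⁻ p q x∈p∪q
  ...     | inj₁ x∈p = x∈p∪q⁺ (inj₁ (x∈p∩q⁺ (x∈p , x∈r)))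
  ...     | inj₂ x∈q = x∈p∪q⁺ (inj₂ (x∈p∩q⁺ (x∈q , r⊆s x∈r)))
  ∪⊆ x∈ | inj₂ x∈[p∩q]∩s with x∈p∩q⁻ (p ∩ q) s x∈[p∩q]∩s
  ...   | x∈p∩q , x∈s = x∈p∪q⁺ (inj₂ (x∈p∩q⁺ (proj₂ (x∈p∩q⁻ p q x∈p∩q) , x∈s)))
  ∩⊆ : ((p ∪ q) ∩ r) ∩ ((p ∩ q) ∩ s) ⊆ (p ∩ r) ∩ (q ∩ s)
  ∩⊆ x∈ with x∈p∩q⁻ ((p ∪ q) ∩ r) _ x∈
  ... | x∈[p∪q]∩r , x∈[p∩q]∩s with x∈p∩q⁻ (p ∪ q) r x∈[p∪q]∩r | x∈p∩q⁻ (p ∩ q) s x∈[p∩q]∩s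
  ...   | _ , x∈r | x∈p∩q , x∈s with x∈p∩q⁻ p q x∈p∩q
  ...     | x∈p , x∈q = x∈p∩q⁺ (x∈p∩q⁺ (x∈p , x∈r) , x∈p∩q⁺ (x∈q , x∈s))

∪-lub : ∀ {n} {p q r : Subset n} → p ⊆ r → q ⊆ r → p ∪ q ⊆ r
∪-lub {p = p} {q} p⊆r q⊆r x∈ with x∈p∪q⁻ p q x∈
... | inj₁ x∈p = p⊆r x∈p
... | inj₂ x∈q = q⊆r x∈q

∩-glb : ∀ {n} {p q r : Subset n} → r ⊆ p → r ⊆ q → r ⊆ p ∩ q
∩-glb r⊆p r⊆q x∈r = x∈p∩q⁺ (r⊆p x∈r , r⊆q x∈r)

∪-monoˡ-⊆ : ∀ {n} {p q : Subset n} r → p ⊆ q → p ∪ r ⊆ q ∪ r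
∪-monoˡ-⊆ {q = q} r p⊆q = ∪-lub (p⊆p∪q r ∘ p⊆q) (q⊆p∪q q r)

∪-monoʳ-⊆ : ∀ {n} p {q r : Subset n} → q ⊆ r → p ∪ q ⊆ p ∪ r
∪-monoʳ-⊆ p {r = r} q⊆r = ∪-lub (p⊆p∪q r) (q⊆p∪q p r ∘ q⊆r)

∩-monoˡ-⊆ : ∀ {n} {p q : Subset n} r → p ⊆ q → p ∩ r ⊆ q ∩ r
∩-monoˡ-⊆ {p = p} r p⊆q = ∩-glb (p⊆q ∘ p∩q⊆p p r) (p∩q⊆q p r)

∩-monoʳ-⊆ : ∀ {n} p {q r : Subset n} → q ⊆ r → p ∩ q ⊆ p ∩ r
∩-monoʳ-⊆ p {q} q⊆r = ∩-glb (p∩q⊆p p q) (q⊆r ∘ p∩q⊆q p q)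

∪⁅x⁆⊆ : ∀ {n} {p q : Subset n} {x} → p ⊆ q → x ∈ q → p ∪ ⁅ x ⁆ ⊆ q
∪⁅x⁆⊆ {x = x} p⊆q x∈q = ∪-lub p⊆q λ y∈ → subst (_∈ _) (sym (x∈⁅y⁆⇒x≡y x y∈)) x∈q

disjoint : ∀ {n} {p q X : Subset n} → p ⊆ ∁ X → q ⊆ X → Empty (p ∩ q)
disjoint {p = p} {q} p⊆∁X q⊆X (x , x∈p∩q) with x∈p∩q⁻ p q x∈p∩q
... | x∈p , x∈q = x∈∁p⇒x∉p (p⊆∁X x∈p) (q⊆X x∈q)

⟦_⟧ : ∀ {n} {P : Fin n → Set} → Decidable P → Subset n
⟦ P? ⟧ = tabulate (does ∘ P?)

module _ {n} {P : Fin n → Set} (P? : Decidable P) where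

  ∈⟦⟧⁺ : ∀ {x} → P x → x ∈ ⟦ P? ⟧
  ∈⟦⟧⁺ {x} px = lookup⇒[]= x _ (trans (lookup∘tabulate _ x) (dec-true (P? x) px))

  ∈⟦⟧⁻ : ∀ {x} → x ∈ ⟦ P? ⟧ → P x
  ∈⟦⟧⁻ {x} x∈ with P? x | trans (sym (lookup∘tabulate (does ∘ P?) x)) ([]=⇒lookup x∈)
  ... | yes px | _ = px

∣⟦t≤j⟧∣≡m∸t : ∀ m t → ∣ ⟦ (λ (j : Fin m) → t ≤? toℕ j) ⟧ ∣ ≡ m ∸ t
∣⟦t≤j⟧∣≡m∸t zero    t       = sym (0∸n≡0 t)
∣⟦t≤j⟧∣≡m∸t (suc m) zero    = cong suc (∣⟦t≤j⟧∣≡m∸t m zero)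
∣⟦t≤j⟧∣≡m∸t (suc m) (suc t) = begin
  ∣ tabulate {n = m} (λ j → does (suc t ≤? suc (toℕ j))) ∣   ≡⟨ cong (∣_∣ {m}) (tabulate-cong shift) ⟩
  ∣ ⟦ (λ (j : Fin m) → t ≤? toℕ j) ⟧ ∣                      ≡⟨ ∣⟦t≤j⟧∣≡m∸t m t ⟩
  m ∸ t                                                     ∎
  where
  open ≡-Reasoning
  shift : ∀ j → does (suc t ≤? suc (toℕ j)) ≡ does (t ≤? toℕ j)
  shift j = does-⇔ (mk⇔ s≤s⁻¹ s≤s) (suc t ≤? suc (toℕ j)) (t ≤? toℕ j)

-- m when P holds nowhere.
firstIndex : ∀ {m} {P : Fin m → Set} → Decidable P → ℕ
firstIndex {zero}  P? = 0
firstIndex {suc m} P? with P? zero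
... | yes _ = 0
... | no  _ = suc (firstIndex (P? ∘ suc))

firstIndex≤m : ∀ {m} {P : Fin m → Set} (P? : Decidable P) → firstIndex P? ≤ m
firstIndex≤m {zero}  P? = z≤n
firstIndex≤m {suc m} P? with P? zero
... | yes _ = z≤n
... | no  _ = s≤s (firstIndex≤m (P? ∘ suc))

firstIndex-least : ∀ {m} {P : Fin m → Set} (P? : Decidable P) {j} → P j → firstIndex P? ≤ toℕ j
firstIndex-least {suc m} P? {j} pj with P? zero | j
... | yes _  | _     = z≤n
... | no ¬p0 | zero  = contradiction pj ¬p0
... | no _   | suc j = s≤s (firstIndex-least (P? ∘ suc) pj)

firstIndex-upward : ∀ {m} {P : Fin m → Set} (P? : Decidable P) →
                    (∀ {j k} → j ≤ᶠ k → P j → P k) → ∀ {j} → firstIndex P? ≤ toℕ j → P j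
firstIndex-upward {suc m} P? up {j} le with P? zero | j
... | yes p0 | _     = up z≤n p0
... | no _   | suc j = firstIndex-upward (P? ∘ suc) (up ∘ s≤s) (s≤s⁻¹ le)

least : ∀ {P : ℕ → Set} → Decidable P → ∀ {k} → P k →
        ∃ λ u → u ≤ k × P u × (∀ {t} → t < u → ¬ P t)
least {P} P? {k} = go k (<-wellFounded k)
  where
  go : ∀ k → Acc _<_ k → P k → ∃ λ u → u ≤ k × P u × (∀ {t} → t < u → ¬ P t)
  go k (acc rs) pk with anyUpTo? P? k
  ... | no none = k , ≤-refl , pk , λ t<k pt → none (_ , t<k , pt)
  ... | yes (t , t<k , pt) with go t (rs t<k) pt
  ...   | u , u≤t , pu , below = u , ≤-trans u≤t (<⇒≤ t<k) , pu , below

module _ (m : ℕ) (f : ℕ → ℕ) where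

  opaque
    private
      u* : ℕ
      u* = argmin f m (upTo m)

    minimum : ℕ
    minimum = f u*

    minimum-attained : ∃ λ u → u ≤ m × minimum ≡ f u
    minimum-attained with argmin-sel f m (upTo m)
    ... | inj₁ u*≡m  = u* , ≤-reflexive u*≡m , refl
    ... | inj₂ u*∈   = u* , <⇒≤ (∈-upTo⁻ u*∈) , refl

    minimum≤ : ∀ {u} → u ≤ m → minimum ≤ f u
    minimum≤ u≤m with m≤n⇒m<n∨m≡n u≤m
    ... | inj₁ u<m  = All.lookup (f[argmin]≤f[xs] {f = f} m (upTo m)) (∈-upTo⁺ u<m)
    ... | inj₂ refl = f[argmin]≤f[⊤] {f = f} m (upTo m)

    minimum-greatest : ∀ {c} → (∀ {u} → u ≤ m → c ≤ f u) → c ≤ minimum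
    minimum-greatest {c} bound with minimum-attained
    ... | u , u≤m , eq = subst (c ≤_) (sym eq) (bound u≤m)

1+n≤2^n : ∀ n → suc n ≤ 2 ^ n
1+n≤2^n zero    = ≤-refl
1+n≤2^n (suc n) = begin
  1 + suc n     ≤⟨ +-mono-≤ (≤-trans (s≤s z≤n) (1+n≤2^n n)) (1+n≤2^n n) ⟩
  2 ^ n + 2 ^ n ≡⟨ cong (2 ^ n +_) (+-identityʳ (2 ^ n)) ⟨
  2 ^ suc n     ∎
  where open ≤-Reasoning

[1+n∸m]*2^m≤2^n : ∀ {m n} → m ≤ n → suc (n ∸ m) * 2 ^ m ≤ 2 ^ n
[1+n∸m]*2^m≤2^n {m} {n} m≤n = begin
  suc (n ∸ m) * 2 ^ m   ≤⟨ *-monoˡ-≤ (2 ^ m) (1+n≤2^n (n ∸ m)) ⟩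
  2 ^ (n ∸ m) * 2 ^ m   ≡⟨ ^-distribˡ-+-* 2 (n ∸ m) m ⟨
  2 ^ (n ∸ m + m)       ≡⟨ cong (2 ^_) (m∸n+n≡m m≤n) ⟩
  2 ^ n                 ∎
  where open ≤-Reasoning

*2^m≤2^n⇒≤2^[n∸m] : ∀ k m n → k * 2 ^ m ≤ 2 ^ n → k ≤ 2 ^ (n ∸ m)
*2^m≤2^n⇒≤2^[n∸m] k m n le with m ≤? n
... | yes m≤n = *-cancelʳ-≤ k _ (2 ^ m) {{m^n≢0 2 m}} (begin
  k * 2 ^ m             ≤⟨ le ⟩
  2 ^ n                 ≡⟨ cong (2 ^_) (m∸n+n≡m m≤n) ⟨
  2 ^ (n ∸ m + m)       ≡⟨ ^-distribˡ-+-* 2 (n ∸ m) m ⟩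
  2 ^ (n ∸ m) * 2 ^ m   ∎)
  where open ≤-Reasoning
... | no m≰n with k
...   | zero  = z≤n
...   | suc k = contradiction (≤-trans (m≤m+n (2 ^ m) (k * 2 ^ m)) le)
                              (<⇒≱ (^-monoʳ-< 2 (s≤s (s≤s z≤n)) (≰⇒> m≰n)))

a∸b≤c∸d : ∀ {a b c d} → b ≤ a → a + d ≤ c + b → a ∸ b ≤ c ∸ d
a∸b≤c∸d {a} {b} {c} {d} b≤a le = m+n≤o⇒m≤o∸n (a ∸ b) (+-cancelʳ-≤ b _ _ (begin
  a ∸ b + d + b ≡⟨ +-assoc (a ∸ b) d b ⟩
  a ∸ b + (d + b) ≡⟨ cong (a ∸ b +_) (+-comm d b) ⟩
  a ∸ b + (b + d) ≡⟨ +-assoc (a ∸ b) b d ⟨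
  a ∸ b + b + d ≡⟨ cong (_+ d) (m∸n+n≡m b≤a) ⟩
  a + d ≤⟨ le ⟩
  c + b ∎))
  where open ≤-Reasoning

∑-telescope : ∀ k (f : ℕ → ℕ) → (∀ j → f (suc j) ≤ f j) →
              ∑[ j < k ] (f (toℕ j) ∸ f (suc (toℕ j))) + f k ≡ f 0
∑-telescope zero    f dec = refl
∑-telescope (suc k) f dec = begin
  (f 0 ∸ f 1) + ∑[ j < k ] (f (suc (toℕ j)) ∸ f (suc (suc (toℕ j)))) + f (suc k)
    ≡⟨ +-assoc (f 0 ∸ f 1) _ _ ⟩
  (f 0 ∸ f 1) + (∑[ j < k ] (f (suc (toℕ j)) ∸ f (suc (suc (toℕ j)))) + f (suc k))
    ≡⟨ cong ((f 0 ∸ f 1) +_) (∑-telescope k (f ∘ suc) (dec ∘ suc)) ⟩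
  (f 0 ∸ f 1) + f 1
    ≡⟨ m∸n+n≡m (dec 0) ⟩
  f 0 ∎
  where open ≡-Reasoning

interval : ℕ → ℕ → List ℕ
interval l h = applyUpTo (l +_) (suc (h ∸ l))

length-interval : ∀ l h → length (interval l h) ≡ suc (h ∸ l)
length-interval l h = length-applyUpTo (l +_) (suc (h ∸ l))

∈-interval : ∀ {l h x} → l ≤ x → x ≤ h → x ∈ˡ interval l h
∈-interval {l} {h} {x} l≤x x≤h =
  subst (_∈ˡ interval l h) (m+[n∸m]≡n l≤x) (∈-applyUpTo⁺ (l +_) (s≤s (∸-monoˡ-≤ l x≤h)))

box : ∀ {k} → (Fin k → ℕ) → (Fin k → ℕ) → List (Vec ℕ k)
box {zero}  lo hi = [ [] ]
box {suc k} lo hi = cartesianProductWith _∷_ (interval (lo zero) (hi zero)) (box (lo ∘ suc) (hi ∘ suc))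

∈-box : ∀ {k} {lo hi f : Fin k → ℕ} → (∀ j → lo j ≤ f j) → (∀ j → f j ≤ hi j) → tabulate f ∈ˡ box lo hi
∈-box {zero}  lo≤ ≤hi = hereˡ refl
∈-box {suc k} lo≤ ≤hi =
  ∈-cartesianProductWith⁺ _∷_ (∈-interval (lo≤ zero) (≤hi zero)) (∈-box (lo≤ ∘ suc) (≤hi ∘ suc))

length-cartesianProductWith : ∀ {A B C : Set} (f : A → B → C) xs ys →
                              length (cartesianProductWith f xs ys) ≡ length xs * length ys
length-cartesianProductWith f List.[]         ys = refl
length-cartesianProductWith f (x List.∷ xs) ys = begin
  length (map (f x) ys ++ cartesianProductWith f xs ys)
    ≡⟨ length-++ (map (f x) ys) ⟩
  length (map (f x) ys) + length (cartesianProductWith f xs ys)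
    ≡⟨ cong₂ _+_ (length-map (f x) ys) (length-cartesianProductWith f xs ys) ⟩
  length ys + length xs * length ys ∎
  where open ≡-Reasoning

length-box : ∀ {k} {lo hi : Fin k → ℕ} → (∀ j → lo j ≤ hi j) → length (box lo hi) * 2 ^ sum lo ≤ 2 ^ sum hi
length-box {zero}  lo≤hi = ≤-refl
length-box {suc k} {lo} {hi} lo≤hi = begin
  length (box lo hi) * 2 ^ (l + sum (lo ∘ suc))
    ≡⟨ cong₂ _*_ (length-cartesianProductWith _∷_ (interval l h) (box (lo ∘ suc) (hi ∘ suc)))
                 (^-distribˡ-+-* 2 l (sum (lo ∘ suc))) ⟩
  (length (interval l h) * length (box (lo ∘ suc) (hi ∘ suc))) * (2 ^ l * 2 ^ sum (lo ∘ suc))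
    ≡⟨ *-CS.interchange (length (interval l h)) (length (box (lo ∘ suc) (hi ∘ suc))) (2 ^ l) (2 ^ sum (lo ∘ suc)) ⟩
  (length (interval l h) * 2 ^ l) * (length (box (lo ∘ suc) (hi ∘ suc)) * 2 ^ sum (lo ∘ suc))
    ≡⟨ cong (λ k → (k * 2 ^ l) * (length (box (lo ∘ suc) (hi ∘ suc)) * 2 ^ sum (lo ∘ suc))) (length-interval l h) ⟩
  (suc (h ∸ l) * 2 ^ l) * (length (box (lo ∘ suc) (hi ∘ suc)) * 2 ^ sum (lo ∘ suc))
    ≤⟨ *-mono-≤ ([1+n∸m]*2^m≤2^n (lo≤hi zero)) (length-box (lo≤hi ∘ suc)) ⟩
  2 ^ h * 2 ^ sum (hi ∘ suc)
    ≡⟨ ^-distribˡ-+-* 2 h _ ⟨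
  2 ^ (h + sum (hi ∘ suc)) ∎
  where
  open ≤-Reasoning
  l = lo zero
  h = hi zero

a∸c≡[a∸b]+[b∸c] : ∀ {a b c} → c ≤ b → b ≤ a → a ∸ c ≡ (a ∸ b) + (b ∸ c)
a∸c≡[a∸b]+[b∸c] {a} {b} {c} c≤b b≤a = begin
  a ∸ c               ≡⟨ cong (_∸ c) (m∸n+n≡m b≤a) ⟨
  (a ∸ b + b) ∸ c     ≡⟨ +-∸-assoc (a ∸ b) c≤b ⟩
  (a ∸ b) + (b ∸ c)   ∎
  where open ≡-Reasoning

-- Matroids given by levels

-- x lies in the j-th set of a nested presentation A₀ ⊆ ⋯ ⊆ Aₘ₋₁ iff lv x ≤ j, so level m means
-- x lies in none of them.  Independent is Hall's condition for such a presentation.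
module LevelMatroid {n} (m : ℕ) (lv : Fin n → ℕ) where

  Level≥ : ℕ → Subset n
  Level≥ t = ⟦ (λ x → t ≤? lv x) ⟧

  ∈Level≥⁺ : ∀ {t x} → t ≤ lv x → x ∈ Level≥ t
  ∈Level≥⁺ = ∈⟦⟧⁺ (λ x → _ ≤? lv x)

  ∈Level≥⁻ : ∀ {t x} → x ∈ Level≥ t → t ≤ lv x
  ∈Level≥⁻ = ∈⟦⟧⁻ (λ x → _ ≤? lv x)

  record Independent (I : Subset n) : Set where
    constructor independent
    field bounded : ∀ {t} → t ≤ m → ∣ I ∩ Level≥ t ∣ + t ≤ m
  open Independent public

  Independent-⊆ : ∀ {I J} → J ⊆ I → Independent I → Independent J
  Independent-⊆ J⊆I indI = independent λ {t} t≤m →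
    ≤-trans (+-monoˡ-≤ t (p⊆q⇒∣p∣≤∣q∣ (∩-monoˡ-⊆ (Level≥ t) J⊆I))) (bounded indI t≤m)

  violation? : ∀ I → Dec (∃ λ t → t < suc m × m < ∣ I ∩ Level≥ t ∣ + t)
  violation? I = anyUpTo? (λ t → m <? ∣ I ∩ Level≥ t ∣ + t) (suc m)

  independent? : ∀ I → Dec (Independent I)
  independent? I with violation? I
  ... | yes (t , t≤m , bad) = no λ indI → <⇒≱ bad (bounded indI (s≤s⁻¹ t≤m))
  ... | no none = yes (independent λ t≤m → ≮⇒≥ (λ bad → none (_ , s≤s t≤m , bad)))

  rankBound : Subset n → ℕ → ℕ
  rankBound S u = (m ∸ u) + ∣ S ∩ ∁ (Level≥ u) ∣

  rank : Subset n → ℕ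
  rank S = minimum m (rankBound S)

  rank≤rankBound : ∀ S {u} → u ≤ m → rank S ≤ rankBound S u
  rank≤rankBound S = minimum≤ m (rankBound S)

  rank≡rankBound : ∀ S → ∃ λ u → u ≤ m × rank S ≡ rankBound S u
  rank≡rankBound S = minimum-attained m (rankBound S)

  ≤rank : ∀ S {c} → (∀ {u} → u ≤ m → c ≤ rankBound S u) → c ≤ rank S
  ≤rank S = minimum-greatest m (rankBound S)

  ∣I∣≤rankBound : ∀ {S I} → I ⊆ S → Independent I → ∀ {u} → u ≤ m → ∣ I ∣ ≤ rankBound S u
  ∣I∣≤rankBound {S} {I} I⊆S indI {u} u≤m = begin
    ∣ I ∣
      ≡⟨ ∣p∩q∣+∣p∩∁q∣≡∣p∣ I (Level≥ u) ⟨
    ∣ I ∩ Level≥ u ∣ + ∣ I ∩ ∁ (Level≥ u) ∣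
      ≤⟨ +-mono-≤ (m+n≤o⇒m≤o∸n _ (bounded indI u≤m)) (p⊆q⇒∣p∣≤∣q∣ (∩-monoˡ-⊆ (∁ (Level≥ u)) I⊆S)) ⟩
    (m ∸ u) + ∣ S ∩ ∁ (Level≥ u) ∣ ∎
    where open ≤-Reasoning

  ∣I∣≤rank : ∀ {S I} → I ⊆ S → Independent I → ∣ I ∣ ≤ rank S
  ∣I∣≤rank {S} I⊆S indI = ≤rank S (∣I∣≤rankBound I⊆S indI)

  rank-mono : ∀ {S T} → S ⊆ T → rank S ≤ rank T
  rank-mono {S} {T} S⊆T = ≤rank T λ {u} u≤m → begin
    rank S          ≤⟨ rank≤rankBound S u≤m ⟩
    rankBound S u   ≤⟨ +-monoʳ-≤ (m ∸ u) (p⊆q⇒∣p∣≤∣q∣ (∩-monoˡ-⊆ (∁ (Level≥ u)) S⊆T)) ⟩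
    rankBound T u   ∎
    where open ≤-Reasoning

  independent-⊥ : Independent ⊥
  independent-⊥ = independent λ {t} t≤m →
    ≤-trans (+-monoˡ-≤ t (≤-trans (p⊆q⇒∣p∣≤∣q∣ (p∩q⊆p ⊥ (Level≥ t))) (≤-reflexive (∣⊥∣≡0 n)))) t≤m

  MaximalIn : Subset n → Subset n → Set
  MaximalIn S I = I ⊆ S × Independent I × (∀ {x} → x ∈ S → x ∉ I → ¬ Independent (I ∪ ⁅ x ⁆))

  opaque
    maximalIn-exists : ∀ S → ∃ (MaximalIn S)
    maximalIn-exists S = grow ⊥ (⊃-wellFounded ⊥) ⊥⊆ independent-⊥
      where
      grow : ∀ I → Acc _⊃_ I → I ⊆ S → Independent I → ∃ (MaximalIn S)
      grow I (acc rs) I⊆S indI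
        with any? (λ x → x ∈? S ×-dec (¬? (x ∈? I) ×-dec independent? (I ∪ ⁅ x ⁆)))
      ... | no none = I , I⊆S , indI , λ x∈S x∉I ind → none (_ , x∈S , x∉I , ind)
      ... | yes (x , x∈S , x∉I , ind) =
        grow (I ∪ ⁅ x ⁆) (rs (p⊆p∪q _ , x , q⊆p∪q I _ (x∈⁅x⁆ x) , x∉I))
             (∪⁅x⁆⊆ I⊆S x∈S) ind

  ¬independent⇒violation : ∀ {I} → ¬ Independent I → ∃ λ t → t ≤ m × m < ∣ I ∩ Level≥ t ∣ + t
  ¬independent⇒violation {I} ¬indI with violation? I
  ... | yes (t , t<1+m , bad) = t , s≤s⁻¹ t<1+m , bad
  ... | no none = contradiction (independent λ {t} t≤m → ≮⇒≥ (λ bad → none (t , s≤s t≤m , bad))) ¬indI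

  blocked-below : ∀ {I x} → Independent I → ¬ Independent (I ∪ ⁅ x ⁆) →
                  ∃ λ t → t ≤ lv x × m ≤ ∣ I ∩ Level≥ t ∣ + t
  blocked-below {I} {x} indI ¬ind with ¬independent⇒violation ¬ind
  ... | t , t≤m , bad with t ≤? lv x
  ...   | yes t≤lvx = t , t≤lvx , s≤s⁻¹ (<-≤-trans bad (+-monoˡ-≤ t ∣[I∪x]∩Level≥∣≤))
    where
    ⊆⁅x⁆∪ : (I ∪ ⁅ x ⁆) ∩ Level≥ t ⊆ ⁅ x ⁆ ∪ (I ∩ Level≥ t)
    ⊆⁅x⁆∪ y∈ with x∈p∩q⁻ (I ∪ ⁅ x ⁆) (Level≥ t) y∈
    ... | y∈I∪x , y∈Level≥ with x∈p∪q⁻ I ⁅ x ⁆ y∈I∪x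
    ...   | inj₁ y∈I = q⊆p∪q ⁅ x ⁆ _ (x∈p∩q⁺ (y∈I , y∈Level≥))
    ...   | inj₂ y∈x = p⊆p∪q _ y∈x
    ∣[I∪x]∩Level≥∣≤ : ∣ (I ∪ ⁅ x ⁆) ∩ Level≥ t ∣ ≤ suc ∣ I ∩ Level≥ t ∣
    ∣[I∪x]∩Level≥∣≤ = ≤-trans (p⊆q⇒∣p∣≤∣q∣ ⊆⁅x⁆∪)
      (≤-trans (∣p∪q∣≤∣p∣+∣q∣ ⁅ x ⁆ (I ∩ Level≥ t)) (≤-reflexive (cong (_+ ∣ I ∩ Level≥ t ∣) (∣⁅x⁆∣≡1 x))))
  ...   | no t≰lvx = contradiction (bounded indI t≤m) (<⇒≱ (<-≤-trans bad (+-monoˡ-≤ t (p⊆q⇒∣p∣≤∣q∣ ⊆I))))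
    where
    ⊆I : (I ∪ ⁅ x ⁆) ∩ Level≥ t ⊆ I ∩ Level≥ t
    ⊆I y∈ with x∈p∩q⁻ (I ∪ ⁅ x ⁆) (Level≥ t) y∈
    ... | y∈I∪x , y∈Level≥ with x∈p∪q⁻ I ⁅ x ⁆ y∈I∪x
    ...   | inj₁ y∈I = x∈p∩q⁺ (y∈I , y∈Level≥)
    ...   | inj₂ y∈x rewrite x∈⁅y⁆⇒x≡y x y∈x = contradiction (∈Level≥⁻ y∈Level≥) t≰lvx

  rank≤∣I∣ : ∀ {S I} → MaximalIn S I → rank S ≤ ∣ I ∣
  rank≤∣I∣ {S} {I} (I⊆S , indI , maximal)
    with least (λ t → m ≤? ∣ I ∩ Level≥ t ∣ + t) (m≤n+m m ∣ I ∩ Level≥ m ∣)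
  ... | u , u≤m , tight , below = begin
    rank S                                    ≤⟨ rank≤rankBound S u≤m ⟩
    (m ∸ u) + ∣ S ∩ ∁ (Level≥ u) ∣            ≤⟨ +-mono-≤ m∸u≤ (p⊆q⇒∣p∣≤∣q∣ low⊆) ⟩
    ∣ I ∩ Level≥ u ∣ + ∣ I ∩ ∁ (Level≥ u) ∣   ≡⟨ ∣p∩q∣+∣p∩∁q∣≡∣p∣ I (Level≥ u) ⟩
    ∣ I ∣                                     ∎
    where
    open ≤-Reasoning
    m∸u≤ : m ∸ u ≤ ∣ I ∩ Level≥ u ∣
    m∸u≤ = subst (m ∸ u ≤_) (m+n∸n≡m _ u) (∸-monoˡ-≤ u tight)
    low⊆ : S ∩ ∁ (Level≥ u) ⊆ I ∩ ∁ (Level≥ u)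
    low⊆ {x} x∈ with x∈p∩q⁻ S (∁ (Level≥ u)) x∈ | x ∈? I
    ... | _ , x∈L | yes x∈I = x∈p∩q⁺ (x∈I , x∈L)
    ... | x∈S , x∈L | no x∉I with blocked-below indI (maximal x∈S x∉I)
    ...   | t , t≤lvx , tight-t = contradiction tight-t (below (≤-<-trans t≤lvx lvx<u))
      where
      lvx<u : lv x < u
      lvx<u = ≰⇒> (λ u≤lvx → x∈∁p⇒x∉p x∈L (∈Level≥⁺ u≤lvx))

  rank-attained : ∀ S → ∃ λ I → I ⊆ S × Independent I × ∣ I ∣ ≡ rank S
  rank-attained S with maximalIn-exists S
  ... | I , max@(I⊆S , indI , _) = I , I⊆S , indI , ≤-antisym (∣I∣≤rank I⊆S indI) (rank≤∣I∣ max)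

  Level≥-anti : ∀ {t u} → t ≤ u → Level≥ u ⊆ Level≥ t
  Level≥-anti t≤u x∈ = ∈Level≥⁺ (≤-trans t≤u (∈Level≥⁻ x∈))

  rankBound-∪-Level≥ : ∀ {S W u} → W ⊆ Level≥ u → rankBound (S ∪ W) u ≤ rankBound S u
  rankBound-∪-Level≥ {S} {W} {u} W⊆Level≥ = +-monoʳ-≤ (m ∸ u) (p⊆q⇒∣p∣≤∣q∣ low⊆)
    where
    low⊆ : (S ∪ W) ∩ ∁ (Level≥ u) ⊆ S ∩ ∁ (Level≥ u)
    low⊆ x∈ with x∈p∩q⁻ (S ∪ W) (∁ (Level≥ u)) x∈
    ... | x∈S∪W , x∈L with x∈p∪q⁻ S W x∈S∪W
    ...   | inj₁ x∈S = x∈p∩q⁺ (x∈S , x∈L)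
    ...   | inj₂ x∈W = contradiction (W⊆Level≥ x∈W) (x∈∁p⇒x∉p x∈L)

  -- Elements of level m lie in no set of the presentation, so they do not change any rank.
  rank-∪-Level≥ : ∀ {S W} → W ⊆ Level≥ m → rank (S ∪ W) ≡ rank S
  rank-∪-Level≥ {S} {W} W⊆Level≥ with rank≡rankBound S
  ... | u , u≤m , rankS≡ = ≤-antisym (begin
    rank (S ∪ W)        ≤⟨ rank≤rankBound (S ∪ W) u≤m ⟩
    rankBound (S ∪ W) u ≤⟨ rankBound-∪-Level≥ {S} {W} {u} (Level≥-anti u≤m ∘ W⊆Level≥) ⟩
    rankBound S u       ≡⟨ rankS≡ ⟨
    rank S              ∎) (rank-mono (p⊆p∪q {p = S} W))
    where open ≤-Reasoning

  rank-submodular-crossing : ∀ A B {u₁ u₂} → u₁ ≤ m → u₂ ≤ m → u₁ ≤ u₂ →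
                             rank (A ∪ B) + rank (A ∩ B) ≤ rankBound A u₁ + rankBound B u₂
  rank-submodular-crossing A B {u₁} {u₂} u₁≤m u₂≤m u₁≤u₂ = begin
    rank (A ∪ B) + rank (A ∩ B)
      ≤⟨ +-mono-≤ (rank≤rankBound (A ∪ B) u₁≤m) (rank≤rankBound (A ∩ B) u₂≤m) ⟩
    ((m ∸ u₁) + ∣ (A ∪ B) ∩ L₁ ∣) + ((m ∸ u₂) + ∣ (A ∩ B) ∩ L₂ ∣)
      ≡⟨ +-CS.interchange (m ∸ u₁) (∣ (A ∪ B) ∩ L₁ ∣) (m ∸ u₂) (∣ (A ∩ B) ∩ L₂ ∣) ⟩
    ((m ∸ u₁) + (m ∸ u₂)) + (∣ (A ∪ B) ∩ L₁ ∣ + ∣ (A ∩ B) ∩ L₂ ∣)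
      ≤⟨ +-monoʳ-≤ ((m ∸ u₁) + (m ∸ u₂)) (∣[p∪q]∩r∣+∣[p∩q]∩s∣≤∣p∩r∣+∣q∩s∣ A B L₁⊆L₂) ⟩
    ((m ∸ u₁) + (m ∸ u₂)) + (∣ A ∩ L₁ ∣ + ∣ B ∩ L₂ ∣)
      ≡⟨ +-CS.interchange (m ∸ u₁) (m ∸ u₂) (∣ A ∩ L₁ ∣) (∣ B ∩ L₂ ∣) ⟩
    ((m ∸ u₁) + ∣ A ∩ L₁ ∣) + ((m ∸ u₂) + ∣ B ∩ L₂ ∣) ∎
    where
    open ≤-Reasoning
    L₁ = ∁ (Level≥ u₁)
    L₂ = ∁ (Level≥ u₂)
    L₁⊆L₂ : L₁ ⊆ L₂
    L₁⊆L₂ = p⊆q⇒∁p⊇∁q {p = Level≥ u₂} {q = Level≥ u₁} (Level≥-anti u₁≤u₂)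

  rank-submodular : ∀ A B → rank (A ∪ B) + rank (A ∩ B) ≤ rank A + rank B
  rank-submodular A B
    with rank≡rankBound A | rank≡rankBound B
  ... | u₁ , u₁≤m , rankA≡ | u₂ , u₂≤m , rankB≡ rewrite rankA≡ | rankB≡ with ≤-total u₁ u₂
  ... | inj₁ u₁≤u₂ = rank-submodular-crossing A B u₁≤m u₂≤m u₁≤u₂
  ... | inj₂ u₂≤u₁ = subst₂ (λ X Y → rank X + rank Y ≤ rankBound A u₁ + rankBound B u₂) (∪-comm B A) (∩-comm B A)
    (≤-trans (rank-submodular-crossing B A u₂≤m u₁≤m u₂≤u₁) (≤-reflexive (+-comm (rankBound B u₂) (rankBound A u₁))))

-- Nested presentations

module NestedPresentation {n m} (A : Fin m → Subset n) (nested : ∀ j k → j ≤ᶠ k → A j ⊆ A k) where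

  level : Fin n → ℕ
  level x = firstIndex (λ j → x ∈? A j)

  level≤m : ∀ x → level x ≤ m
  level≤m x = firstIndex≤m (λ j → x ∈? A j)

  ∈A⇒level≤ : ∀ {x j} → x ∈ A j → level x ≤ toℕ j
  ∈A⇒level≤ {x} = firstIndex-least (λ j → x ∈? A j)

  level≤⇒∈A : ∀ {x j} → level x ≤ toℕ j → x ∈ A j
  level≤⇒∈A {x} = firstIndex-upward (λ j → x ∈? A j) (λ {j} {k} j≤k → nested j k j≤k)

  open LevelMatroid m level

  transIndep⇒∣I∩Level≥∣≤m∸t : ∀ {I} → TransIndep A I → ∀ t → ∣ I ∩ Level≥ t ∣ ≤ m ∸ t
  transIndep⇒∣I∩Level≥∣≤m∸t {I} (φ , injective , φ-valid) t = begin
    ∣ I ∩ Level≥ t ∣                       ≤⟨ injectiveOn⇒∣p∣≤∣q∣ φ into inj ⟩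
    ∣ ⟦ (λ (j : Fin m) → t ≤? toℕ j) ⟧ ∣   ≡⟨ ∣⟦t≤j⟧∣≡m∸t m t ⟩
    m ∸ t                                  ∎
    where
    open ≤-Reasoning
    into : ∀ {x} → x ∈ I ∩ Level≥ t → φ x ∈ ⟦ (λ (j : Fin m) → t ≤? toℕ j) ⟧
    into x∈ with x∈p∩q⁻ I (Level≥ t) x∈
    ... | x∈I , x∈Level≥ = ∈⟦⟧⁺ (λ j → t ≤? toℕ j) (≤-trans (∈Level≥⁻ x∈Level≥) (∈A⇒level≤ (φ-valid _ x∈I)))
    inj : ∀ {x y} → x ∈ I ∩ Level≥ t → y ∈ I ∩ Level≥ t → φ x ≡ φ y → x ≡ y
    inj x∈ y∈ = injective _ _ (proj₁ (x∈p∩q⁻ I (Level≥ t) x∈)) (proj₁ (x∈p∩q⁻ I (Level≥ t) y∈))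

  transIndep⇒independent : ∀ {I} → TransIndep A I → Independent I
  transIndep⇒independent trans-I =
    independent λ {t} t≤m → m≤o∸n⇒m+n≤o _ t≤m (transIndep⇒∣I∩Level≥∣≤m∸t trans-I t)

  _≼_ : Fin n → Fin n → Set
  y ≼ x = level x < level y ⊎ (level y ≡ level x × toℕ y ≤ toℕ x)

  _≼?_ : ∀ y x → Dec (y ≼ x)
  y ≼? x = (level x <? level y) ⊎-dec ((level y ≟ level x) ×-dec (toℕ y ≤? toℕ x))

  ≼-refl : ∀ {x} → x ≼ x
  ≼-refl = inj₂ (refl , ≤-refl)

  ≼-trans : ∀ {x y z} → x ≼ y → y ≼ z → x ≼ z
  ≼-trans (inj₁ a)       (inj₁ b)       = inj₁ (<-trans b a)
  ≼-trans (inj₁ a)       (inj₂ (e , _)) = inj₁ (subst (_< _) e a)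
  ≼-trans (inj₂ (e , _)) (inj₁ b)       = inj₁ (subst (_ <_) (sym e) b)
  ≼-trans (inj₂ (e , a)) (inj₂ (f , b)) = inj₂ (trans e f , ≤-trans a b)

  ≼-antisym : ∀ {x y} → x ≼ y → y ≼ x → x ≡ y
  ≼-antisym (inj₁ a)       (inj₁ b)       = contradiction a (<-asym b)
  ≼-antisym (inj₁ a)       (inj₂ (e , _)) = contradiction a (<-irrefl e)
  ≼-antisym (inj₂ (e , _)) (inj₁ b)       = contradiction b (<-irrefl e)
  ≼-antisym (inj₂ (_ , a)) (inj₂ (_ , b)) = toℕ-injective (≤-antisym a b)

  ≼-total : ∀ x y → x ≼ y ⊎ y ≼ x
  ≼-total x y with <-cmp (level x) (level y) | ≤-total (toℕ x) (toℕ y)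
  ... | tri< lx<ly _ _ | _      = inj₂ (inj₁ lx<ly)
  ... | tri> _ _ ly<lx | _      = inj₁ (inj₁ ly<lx)
  ... | tri≈ _ e _     | inj₁ a = inj₁ (inj₂ (e , a))
  ... | tri≈ _ e _     | inj₂ b = inj₂ (inj₂ (sym e , b))

  position : Subset n → Fin n → ℕ
  position I x = ∣ I ∩ ⟦ (_≼? x) ⟧ ∣

  module _ {I : Subset n} where

    1≤position : ∀ {x} → x ∈ I → 1 ≤ position I x
    1≤position {x} x∈I = ≤-trans (≤-reflexive (sym (∣⁅x⁆∣≡1 x)))
      (p⊆q⇒∣p∣≤∣q∣ λ y∈ → subst (_∈ I ∩ ⟦ (_≼? x) ⟧) (sym (x∈⁅y⁆⇒x≡y x y∈)) (x∈p∩q⁺ (x∈I , ∈⟦⟧⁺ (_≼? x) ≼-refl)))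

    position≤ : ∀ x → position I x ≤ ∣ I ∩ Level≥ (level x) ∣
    position≤ x = p⊆q⇒∣p∣≤∣q∣ (∩-monoʳ-⊆ I (λ y∈ → ∈Level≥⁺ (≼⇒level≥ (∈⟦⟧⁻ (_≼? x) y∈))))
      where
      ≼⇒level≥ : ∀ {y} → y ≼ x → level x ≤ level y
      ≼⇒level≥ (inj₁ a)       = <⇒≤ a
      ≼⇒level≥ (inj₂ (e , _)) = ≤-reflexive (sym e)

    position-strict : ∀ {x y} → y ∈ I → x ≢ y → x ≼ y → position I x < position I y
    position-strict {x} {y} y∈I x≢y x≼y = p⊂q⇒∣p∣<∣q∣ (∩-monoʳ-⊆ I ≼x⊆≼y , y , y∈≼y , y∉≼x)
      where
      ≼x⊆≼y : ⟦ (_≼? x) ⟧ ⊆ ⟦ (_≼? y) ⟧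
      ≼x⊆≼y z∈ = ∈⟦⟧⁺ (_≼? y) (≼-trans (∈⟦⟧⁻ (_≼? x) z∈) x≼y)
      y∈≼y : y ∈ I ∩ ⟦ (_≼? y) ⟧
      y∈≼y = x∈p∩q⁺ (y∈I , ∈⟦⟧⁺ (_≼? y) ≼-refl)
      y∉≼x : y ∉ I ∩ ⟦ (_≼? x) ⟧
      y∉≼x y∈ = x≢y (≼-antisym x≼y (∈⟦⟧⁻ (_≼? x) (proj₂ (x∈p∩q⁻ I _ y∈))))

    position-injective : ∀ {x y} → x ∈ I → y ∈ I → position I x ≡ position I y → x ≡ y
    position-injective {x} {y} x∈I y∈I e with x ≟ᶠ y
    ... | yes x≡y = x≡y
    ... | no x≢y with ≼-total x y
    ...   | inj₁ x≼y = contradiction e (<⇒≢ (position-strict y∈I x≢y x≼y))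
    ...   | inj₂ y≼x = contradiction (sym e) (<⇒≢ (position-strict x∈I (x≢y ∘ sym) y≼x))

  -- Listing I by decreasing level, its k-th element x is sent to index m ∸ k, which is ≥ level x
  -- because at least k elements of I have level ≥ level x.  The function Fin n → Fin m only supplies
  -- values of φ outside I.
  independent⇒transIndep : ∀ {I} → (Fin n → Fin m) → Independent I → TransIndep A I
  independent⇒transIndep {I} default indI = φ , φ-injective , φ-valid
    where
    φ : Fin n → Fin m
    φ x with m ∸ position I x <? m
    ... | yes k<m = fromℕ< k<m
    ... | no  _   = default x

    position+level≤m : ∀ {x} → x ∈ I → position I x + level x ≤ m
    position+level≤m {x} x∈I = ≤-trans (+-monoˡ-≤ (level x) (position≤ {I} x)) (bounded indI (level≤m x))

    toℕ-φ : ∀ {x} → x ∈ I → toℕ (φ x) ≡ m ∸ position I x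
    toℕ-φ {x} x∈I with m ∸ position I x <? m
    ... | yes k<m = toℕ-fromℕ< k<m
    ... | no  k≮m =
      contradiction (∸-monoʳ-< (1≤position {I} x∈I) (≤-trans (m≤m+n _ _) (position+level≤m x∈I))) k≮m

    φ-valid : ∀ x → x ∈ I → x ∈ A (φ x)
    φ-valid x x∈I = level≤⇒∈A (subst (level x ≤_) (sym (toℕ-φ x∈I))
      (m+n≤o⇒m≤o∸n (level x) (subst (_≤ m) (+-comm (position I x) (level x)) (position+level≤m x∈I))))

    φ-injective : ∀ x y → x ∈ I → y ∈ I → φ x ≡ φ y → x ≡ y
    φ-injective x y x∈I y∈I e = position-injective {I} x∈I y∈I
      (∸-cancelˡ-≡ (≤-trans (m≤m+n _ _) (position+level≤m x∈I)) (≤-trans (m≤m+n _ _) (position+level≤m y∈I))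
        (trans (sym (toℕ-φ x∈I)) (trans (cong toℕ e) (toℕ-φ y∈I))))

nested⇒levelMatroid : ∀ {n} (M : Matroid n) → IsNested M →
  Σ ℕ λ m → Σ (Fin n → ℕ) λ lv → ∀ I → Indep M I ⇔ LevelMatroid.Independent m lv I
nested⇒levelMatroid M (m , A , nested , indep⇔trans) =
  m , level , λ I → mk⇔ (transIndep⇒independent ∘ Equivalence.to (indep⇔trans I))
                        (Equivalence.from (indep⇔trans I) ∘ independent⇒transIndep default)
  where
  open NestedPresentation A nested
  default : Fin _ → Fin m
  default = proj₁ (Equivalence.to (indep⇔trans ⊥) (indep-∅ M))

-- Minors

module LevelMatroidMinors {n} (M : Matroid n) (m : ℕ) (lv : Fin n → ℕ)
  (indep⇔ : ∀ I → Indep M I ⇔ LevelMatroid.Independent m lv I) where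

  open LevelMatroid m lv

  to-indep : ∀ {I} → Indep M I → Independent I
  to-indep {I} = Equivalence.to (indep⇔ I)

  from-indep : ∀ {I} → Independent I → Indep M I
  from-indep {I} = Equivalence.from (indep⇔ I)

  IsRank⇒rank≡ : ∀ {S k} → IsRank M S k → rank S ≡ k
  IsRank⇒rank≡ {S} {k} ((I , I⊆S , indI , ∣I∣≡k) , maximum) with rank-attained S
  ... | J , J⊆S , indJ , ∣J∣≡rank = ≤-antisym
    (subst (_≤ k) ∣J∣≡rank (maximum J J⊆S (from-indep indJ)))
    (subst (_≤ rank S) ∣I∣≡k (∣I∣≤rank I⊆S (to-indep indI)))

  IsBasis⇒∣B∣≡rank : ∀ {Y B} → IsBasis M Y B → ∣ B ∣ ≡ rank Y
  IsBasis⇒∣B∣≡rank {Y} {B} (B⊆Y , indB , maximal) =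
    ≤-antisym (∣I∣≤rank B⊆Y (to-indep indB)) (rank≤∣I∣ (B⊆Y , to-indep indB , blocked))
    where
    blocked : ∀ {x} → x ∈ Y → x ∉ B → ¬ Independent (B ∪ ⁅ x ⁆)
    blocked {x} x∈Y x∉B ind =
      x∉B (maximal (B ∪ ⁅ x ⁆) (p⊆p∪q ⁅ x ⁆) (∪⁅x⁆⊆ B⊆Y x∈Y) (from-indep ind) (q⊆p∪q B _ (x∈⁅x⁆ x)))

  rank≤∣B∣⇒IsBasis : ∀ {Y B} → B ⊆ Y → Independent B → rank Y ≤ ∣ B ∣ → IsBasis M Y B
  rank≤∣B∣⇒IsBasis {Y} {B} B⊆Y indB rank≤ = B⊆Y , from-indep indB , λ J B⊆J J⊆Y indJ →
    p⊆q⇒∣q∣≤∣p∣⇒q⊆p B⊆J (≤-trans (∣I∣≤rank J⊆Y (to-indep indJ)) rank≤)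

  -- A maximum independent subset J of I ∪ Y must contain I and meet Y in a basis.
  ∣I∣+rank≤rank⇒MinorIndep : ∀ {Y I} → ∣ I ∣ + rank Y ≤ rank (I ∪ Y) → MinorIndep M Y I
  ∣I∣+rank≤rank⇒MinorIndep {Y} {I} big with rank-attained (I ∪ Y)
  ... | J , J⊆I∪Y , indJ , ∣J∣≡rank = J ∩ Y , basis , from-indep (Independent-⊆ I∪B⊆J indJ)
    where
    J⊆ : J ⊆ (J ∩ I) ∪ (J ∩ Y)
    J⊆ x∈J with x∈p∪q⁻ I Y (J⊆I∪Y x∈J)
    ... | inj₁ x∈I = p⊆p∪q (J ∩ Y) (x∈p∩q⁺ (x∈J , x∈I))
    ... | inj₂ x∈Y = q⊆p∪q (J ∩ I) (J ∩ Y) (x∈p∩q⁺ (x∈J , x∈Y))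
    ∣J∩Y∣≤rank : ∣ J ∩ Y ∣ ≤ rank Y
    ∣J∩Y∣≤rank = ∣I∣≤rank (p∩q⊆q J Y) (Independent-⊆ (p∩q⊆p J Y) indJ)
    squeeze : ∣ I ∣ + rank Y ≤ ∣ J ∩ I ∣ + ∣ J ∩ Y ∣
    squeeze = begin
      ∣ I ∣ + rank Y            ≤⟨ big ⟩
      rank (I ∪ Y)              ≡⟨ ∣J∣≡rank ⟨
      ∣ J ∣                     ≤⟨ p⊆q⇒∣p∣≤∣q∣ J⊆ ⟩
      ∣ (J ∩ I) ∪ (J ∩ Y) ∣     ≤⟨ ∣p∪q∣≤∣p∣+∣q∣ (J ∩ I) (J ∩ Y) ⟩
      ∣ J ∩ I ∣ + ∣ J ∩ Y ∣     ∎
      where open ≤-Reasoning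
    I⊆J : I ⊆ J
    I⊆J = p∩q⊆p J I ∘ p⊆q⇒∣q∣≤∣p∣⇒q⊆p (p∩q⊆q J I)
      (+-cancelʳ-≤ (rank Y) _ _ (≤-trans squeeze (+-monoʳ-≤ ∣ J ∩ I ∣ ∣J∩Y∣≤rank)))
    basis : IsBasis M Y (J ∩ Y)
    basis = rank≤∣B∣⇒IsBasis (p∩q⊆q J Y) (Independent-⊆ (p∩q⊆p J Y) indJ)
      (+-cancelˡ-≤ ∣ I ∣ _ _ (≤-trans squeeze (+-monoˡ-≤ ∣ J ∩ Y ∣ (p⊆q⇒∣p∣≤∣q∣ (p∩q⊆q J I)))))
    I∪B⊆J : I ∪ (J ∩ Y) ⊆ J
    I∪B⊆J = ∪-lub I⊆J (p∩q⊆p J Y)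

  module _ (X : Subset n) where

    ρ : Subset n → ℕ → ℕ
    ρ Y t = rank (Y ∪ (∁ X ∩ Level≥ t))

    ρ-anti : ∀ Y {t u} → t ≤ u → ρ Y u ≤ ρ Y t
    ρ-anti Y t≤u = rank-mono (∪-monoʳ-⊆ Y (∩-monoʳ-⊆ (∁ X) (Level≥-anti t≤u)))

    ρ-m : ∀ Y → ρ Y m ≡ rank Y
    ρ-m Y = rank-∪-Level≥ {Y} (p∩q⊆q (∁ X) (Level≥ m))

    MinorIndep⇒ : ∀ {Y I} → Y ⊆ X → I ⊆ ∁ X → MinorIndep M Y I →
                  ∀ t → ∣ I ∩ Level≥ t ∣ + rank Y ≤ ρ Y t
    MinorIndep⇒ {Y} {I} Y⊆X I⊆∁X (B , basis@(B⊆Y , _ , _) , indI∪B) t = begin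
      ∣ I ∩ Level≥ t ∣ + rank Y
        ≡⟨ cong (∣ I ∩ Level≥ t ∣ +_) (IsBasis⇒∣B∣≡rank basis) ⟨
      ∣ I ∩ Level≥ t ∣ + ∣ B ∣
        ≡⟨ ∣p∪q∣≡∣p∣+∣q∣ (disjoint (I⊆∁X ∘ p∩q⊆p I (Level≥ t)) (Y⊆X ∘ B⊆Y)) ⟨
      ∣ (I ∩ Level≥ t) ∪ B ∣
        ≤⟨ ∣I∣≤rank ⊆Y∪ (Independent-⊆ (∪-monoˡ-⊆ B (p∩q⊆p I (Level≥ t))) (to-indep indI∪B)) ⟩
      ρ Y t ∎
      where
      open ≤-Reasoning
      ⊆Y∪ : (I ∩ Level≥ t) ∪ B ⊆ Y ∪ (∁ X ∩ Level≥ t)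
      ⊆Y∪ = ∪-lub (q⊆p∪q Y _ ∘ ∩-monoˡ-⊆ (Level≥ t) I⊆∁X) (p⊆p∪q _ ∘ B⊆Y)

    ⇒MinorIndep : ∀ {Y I} → Y ⊆ X → I ⊆ ∁ X → (∀ {t} → t ≤ m → ∣ I ∩ Level≥ t ∣ + rank Y ≤ ρ Y t) →
                  MinorIndep M Y I
    ⇒MinorIndep {Y} {I} Y⊆X I⊆∁X bounds = ∣I∣+rank≤rank⇒MinorIndep (≤rank (I ∪ Y) ≤rankBound)
      where
      ∣I∩L∣+∣Y∩L∣≤ : ∀ L → ∣ I ∩ L ∣ + ∣ Y ∩ L ∣ ≤ ∣ (I ∪ Y) ∩ L ∣
      ∣I∩L∣+∣Y∩L∣≤ L = begin
        ∣ I ∩ L ∣ + ∣ Y ∩ L ∣     ≡⟨ ∣p∪q∣≡∣p∣+∣q∣ (disjoint (I⊆∁X ∘ p∩q⊆p I L) (Y⊆X ∘ p∩q⊆p Y L)) ⟨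
        ∣ (I ∩ L) ∪ (Y ∩ L) ∣     ≤⟨ p⊆q⇒∣p∣≤∣q∣ (∪-lub (∩-monoˡ-⊆ L (p⊆p∪q Y)) (∩-monoˡ-⊆ L (q⊆p∪q I Y))) ⟩
        ∣ (I ∪ Y) ∩ L ∣           ∎
        where open ≤-Reasoning
      ≤rankBound : ∀ {u} → u ≤ m → ∣ I ∣ + rank Y ≤ rankBound (I ∪ Y) u
      ≤rankBound {u} u≤m = begin
        ∣ I ∣ + rank Y
          ≡⟨ cong (_+ rank Y) (∣p∩q∣+∣p∩∁q∣≡∣p∣ I (Level≥ u)) ⟨
        (∣ I ∩ Level≥ u ∣ + ∣ I ∩ L ∣) + rank Y
          ≡⟨ +-CS.xy∙z≈xz∙y (∣ I ∩ Level≥ u ∣) (∣ I ∩ L ∣) (rank Y) ⟩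
        (∣ I ∩ Level≥ u ∣ + rank Y) + ∣ I ∩ L ∣
          ≤⟨ +-monoˡ-≤ (∣ I ∩ L ∣) (bounds u≤m) ⟩
        ρ Y u + ∣ I ∩ L ∣
          ≤⟨ +-monoˡ-≤ (∣ I ∩ L ∣) (rank≤rankBound (Y ∪ (∁ X ∩ Level≥ u)) u≤m) ⟩
        rankBound (Y ∪ (∁ X ∩ Level≥ u)) u + ∣ I ∩ L ∣
          ≤⟨ +-monoˡ-≤ (∣ I ∩ L ∣) (rankBound-∪-Level≥ {Y} {∁ X ∩ Level≥ u} {u} (p∩q⊆q (∁ X) (Level≥ u))) ⟩
        ((m ∸ u) + ∣ Y ∩ L ∣) + ∣ I ∩ L ∣
          ≡⟨ +-CS.xy∙z≈x∙zy (m ∸ u) (∣ Y ∩ L ∣) (∣ I ∩ L ∣) ⟩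
        (m ∸ u) + (∣ I ∩ L ∣ + ∣ Y ∩ L ∣)
          ≤⟨ +-monoʳ-≤ (m ∸ u) (∣I∩L∣+∣Y∩L∣≤ L) ⟩
        rankBound (I ∪ Y) u ∎
        where
        open ≤-Reasoning
        L = ∁ (Level≥ u)

    MinorIndep⇔ : ∀ {Y I} → Y ⊆ X → I ⊆ ∁ X →
                  MinorIndep M Y I ⇔ (∀ {t} → t ≤ m → ∣ I ∩ Level≥ t ∣ ≤ ρ Y t ∸ ρ Y m)
    MinorIndep⇔ {Y} {I} Y⊆X I⊆∁X = mk⇔
      (λ minor {t} _ → m+n≤o⇒m≤o∸n _
        (subst (λ r → ∣ I ∩ Level≥ t ∣ + r ≤ ρ Y t) (sym (ρ-m Y)) (MinorIndep⇒ Y⊆X I⊆∁X minor t)))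
      (λ bounds → ⇒MinorIndep Y⊆X I⊆∁X λ {t} t≤m →
        subst (λ r → ∣ I ∩ Level≥ t ∣ + r ≤ ρ Y t) (ρ-m Y) (m≤o∸n⇒m+n≤o _ (ρ-anti Y t≤m) (bounds t≤m)))

    ρ-submodular : ∀ {Y′ Y″} → Y′ ⊆ Y″ → ∀ t → ρ Y″ t + ρ Y′ (suc t) ≤ ρ Y′ t + ρ Y″ (suc t)
    ρ-submodular {Y′} {Y″} Y′⊆Y″ t = begin
      ρ Y″ t + ρ Y′ (suc t)
        ≤⟨ +-mono-≤ (rank-mono {Y″ ∪ Zₜ} {A ∪ B} ⊆A∪B) (rank-mono {Y′ ∪ Zₜ₊₁} {A ∩ B} ⊆A∩B) ⟩
      rank (A ∪ B) + rank (A ∩ B)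
        ≤⟨ rank-submodular A B ⟩
      ρ Y′ t + ρ Y″ (suc t) ∎
      where
      open ≤-Reasoning
      Zₜ = ∁ X ∩ Level≥ t
      Zₜ₊₁ = ∁ X ∩ Level≥ (suc t)
      A = Y′ ∪ Zₜ
      B = Y″ ∪ Zₜ₊₁
      Zₜ₊₁⊆Zₜ : Zₜ₊₁ ⊆ Zₜ
      Zₜ₊₁⊆Zₜ = ∩-monoʳ-⊆ (∁ X) (Level≥-anti (n≤1+n t))
      ⊆A∪B : Y″ ∪ Zₜ ⊆ A ∪ B
      ⊆A∪B = ∪-lub (q⊆p∪q A B ∘ p⊆p∪q Zₜ₊₁) (p⊆p∪q B ∘ q⊆p∪q Y′ Zₜ)
      ⊆A∩B : Y′ ∪ Zₜ₊₁ ⊆ A ∩ B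
      ⊆A∩B = ∩-glb (∪-monoʳ-⊆ Y′ Zₜ₊₁⊆Zₜ) (∪-monoˡ-⊆ Zₜ₊₁ Y′⊆Y″)

    decrement : Subset n → Fin m → ℕ
    decrement Y j = ρ Y (toℕ j) ∸ ρ Y (suc (toℕ j))

    decrement-anti : ∀ {Y′ Y″} → Y′ ⊆ Y″ → ∀ j → decrement Y″ j ≤ decrement Y′ j
    decrement-anti {Y′} {Y″} Y′⊆Y″ j =
      a∸b≤c∸d {ρ Y″ t} {ρ Y″ (suc t)} {ρ Y′ t} {ρ Y′ (suc t)} (ρ-anti Y″ (n≤1+n t)) (ρ-submodular Y′⊆Y″ t)
      where t = toℕ j

    profile : Subset n → Vec ℕ m
    profile Y = tabulate (decrement Y)

    profile≡⇒ρ∸ρ≡ : ∀ {Y Y′} → profile Y ≡ profile Y′ → ∀ {t} → t ≤ m → ρ Y t ∸ ρ Y m ≡ ρ Y′ t ∸ ρ Y′ m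
    profile≡⇒ρ∸ρ≡ {Y} {Y′} same {t} t≤m = descend (m ∸ t) t (m∸n+n≡m t≤m)
      where
      step : ∀ Y {t} (t<m : t < m) → ρ Y t ∸ ρ Y m ≡ decrement Y (fromℕ< t<m) + (ρ Y (suc t) ∸ ρ Y m)
      step Y {t} t<m = trans (a∸c≡[a∸b]+[b∸c] (ρ-anti Y t<m) (ρ-anti Y (n≤1+n t)))
        (cong (λ s → (ρ Y s ∸ ρ Y (suc s)) + (ρ Y (suc t) ∸ ρ Y m)) (sym (toℕ-fromℕ< t<m)))
      same-decrement : ∀ j → decrement Y j ≡ decrement Y′ j
      same-decrement j = trans (sym (lookup∘tabulate (decrement Y) j))
        (trans (cong (λ v → lookup v j) same) (lookup∘tabulate (decrement Y′) j))
      descend : ∀ k t → k + t ≡ m → ρ Y t ∸ ρ Y m ≡ ρ Y′ t ∸ ρ Y′ m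
      descend zero    t refl = trans (n∸n≡0 (ρ Y t)) (sym (n∸n≡0 (ρ Y′ t)))
      descend (suc k) t k+t≡m = begin
        ρ Y t ∸ ρ Y m
          ≡⟨ step Y t<m ⟩
        decrement Y j + (ρ Y (suc t) ∸ ρ Y m)
          ≡⟨ cong₂ _+_ (same-decrement j) (descend k (suc t) (trans (+-suc k t) k+t≡m)) ⟩
        decrement Y′ j + (ρ Y′ (suc t) ∸ ρ Y′ m)
          ≡⟨ step Y′ t<m ⟨
        ρ Y′ t ∸ ρ Y′ m ∎
        where
        open ≡-Reasoning
        t<m : t < m
        t<m = subst (t <_) k+t≡m (s≤s (m≤n+m t k))
        j = fromℕ< t<m

    sameProfile⇒sameMinor : ∀ {Y Y′} → Y ⊆ X → Y′ ⊆ X → profile Y ≡ profile Y′ →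
                            ∀ I → I ⊆ ∁ X → MinorIndep M Y I ⇔ MinorIndep M Y′ I
    sameProfile⇒sameMinor Y⊆X Y′⊆X same I I⊆∁X =
      mk⇔ (transfer Y⊆X Y′⊆X same) (transfer Y′⊆X Y⊆X (sym same))
      where
      transfer : ∀ {Y Y′} → Y ⊆ X → Y′ ⊆ X → profile Y ≡ profile Y′ → MinorIndep M Y I → MinorIndep M Y′ I
      transfer {Y} {Y′} Y⊆X Y′⊆X same minor = Equivalence.from (MinorIndep⇔ Y′⊆X I⊆∁X) λ {t} t≤m →
        subst (∣ I ∩ Level≥ t ∣ ≤_) (profile≡⇒ρ∸ρ≡ {Y} {Y′} same t≤m)
              (Equivalence.to (MinorIndep⇔ Y⊆X I⊆∁X) minor t≤m)

    profiles : List (Vec ℕ m)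
    profiles = box (decrement X) (decrement ⊥)

    profile∈profiles : ∀ {Y} → Y ⊆ X → profile Y ∈ˡ profiles
    profile∈profiles {Y} Y⊆X = ∈-box (decrement-anti {Y} {X} Y⊆X) (decrement-anti {⊥} {Y} ⊥⊆)

    -- ⊥ when no Y ⊆ X has profile v.
    representative : Vec ℕ m → Subset n
    representative v with anySubset? (λ Y → (Y ⊆? X) ×-dec (≡-dec _≟_ (profile Y) v))
    ... | yes (Y , _) = Y
    ... | no  _       = ⊥

    representative⊆X : ∀ v → representative v ⊆ X
    representative⊆X v with anySubset? (λ Y → (Y ⊆? X) ×-dec (≡-dec _≟_ (profile Y) v))
    ... | yes (_ , Y⊆X , _) = Y⊆X
    ... | no  _             = ⊥⊆

    profile-representative : ∀ {Y} → Y ⊆ X → profile (representative (profile Y)) ≡ profile Y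
    profile-representative {Y} Y⊆X with anySubset? (λ Y′ → (Y′ ⊆? X) ×-dec (≡-dec _≟_ (profile Y′) (profile Y)))
    ... | yes (_ , _ , same) = same
    ... | no  none           = contradiction (Y , (λ {x} → Y⊆X {x}) , refl) none

    representatives : List (Subset n)
    representatives = map representative profiles

    ∑decrement+rank≡ρ0 : ∀ Y → sum (decrement Y) + rank Y ≡ ρ Y 0
    ∑decrement+rank≡ρ0 Y = trans (cong (sum (decrement Y) +_) (sym (ρ-m Y)))
                                 (∑-telescope m (ρ Y) (λ t → ρ-anti Y (n≤1+n t)))

    rank⊤≤ρX0 : rank ⊤ ≤ ρ X 0
    rank⊤≤ρX0 = rank-mono {⊤} {X ∪ (∁ X ∩ Level≥ 0)} ⊤⊆
      where
      ⊤⊆ : ⊤ ⊆ X ∪ (∁ X ∩ Level≥ 0)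
      ⊤⊆ {x} _ with x ∈? X
      ... | yes x∈X = p⊆p∪q _ x∈X
      ... | no  x∉X = q⊆p∪q X _ (x∈p∩q⁺ (x∉p⇒x∈∁p x∉X , ∈Level≥⁺ z≤n))

    ∑decrement⊥≤rank∁X : sum (decrement ⊥) ≤ rank (∁ X)
    ∑decrement⊥≤rank∁X = begin
      sum (decrement ⊥)              ≤⟨ m≤m+n _ _ ⟩
      sum (decrement ⊥) + rank ⊥     ≡⟨ ∑decrement+rank≡ρ0 ⊥ ⟩
      ρ ⊥ 0                          ≤⟨ rank-mono {⊥ ∪ Z₀} {∁ X} (∪-lub ⊥⊆ (p∩q⊆p (∁ X) (Level≥ 0))) ⟩
      rank (∁ X)                     ∎
      where
      open ≤-Reasoning
      Z₀ = ∁ X ∩ Level≥ 0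

    length-representatives : length representatives * 2 ^ rank ⊤ ≤ 2 ^ (rank X + rank (∁ X))
    length-representatives = begin
      length representatives * 2 ^ rank ⊤
        ≤⟨ *-monoʳ-≤ (length representatives) (^-monoʳ-≤ 2 rank⊤≤ρX0) ⟩
      length representatives * 2 ^ ρ X 0
        ≡⟨ cong₂ (λ k r → k * 2 ^ r) (length-map representative profiles) (sym (∑decrement+rank≡ρ0 X)) ⟩
      length profiles * 2 ^ (sum (decrement X) + rank X)
        ≡⟨ cong (length profiles *_) (^-distribˡ-+-* 2 (sum (decrement X)) (rank X)) ⟩
      length profiles * (2 ^ sum (decrement X) * 2 ^ rank X)
        ≡⟨ *-assoc (length profiles) (2 ^ sum (decrement X)) (2 ^ rank X) ⟨
      length profiles * 2 ^ sum (decrement X) * 2 ^ rank X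
        ≤⟨ *-monoˡ-≤ (2 ^ rank X) (length-box (decrement-anti {⊥} {X} ⊥⊆)) ⟩
      2 ^ sum (decrement ⊥) * 2 ^ rank X
        ≡⟨ ^-distribˡ-+-* 2 (sum (decrement ⊥)) (rank X) ⟨
      2 ^ (sum (decrement ⊥) + rank X)
        ≤⟨ ^-monoʳ-≤ 2 (+-monoˡ-≤ (rank X) ∑decrement⊥≤rank∁X) ⟩
      2 ^ (rank (∁ X) + rank X)
        ≡⟨ cong (2 ^_) (+-comm (rank (∁ X)) (rank X)) ⟩
      2 ^ (rank X + rank (∁ X)) ∎
      where open ≤-Reasoning

    length-representatives≤ : ∀ {a b c} → IsRank M X a → IsRank M (∁ X) b → IsRank M ⊤ c →
                              length representatives ≤ 2 ^ (a + b ∸ c)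
    length-representatives≤ {a} {b} {c} rank-a rank-b rank-c = *2^m≤2^n⇒≤2^[n∸m] _ c (a + b)
      (subst₂ (λ r s → length representatives * 2 ^ r ≤ 2 ^ s) (IsRank⇒rank≡ rank-c)
        (cong₂ _+_ (IsRank⇒rank≡ rank-a) (IsRank⇒rank≡ rank-b)) length-representatives)

    ∈representatives⇒⊆X : ∀ {Y} → Y ∈ˡ representatives → Y ⊆ X
    ∈representatives⇒⊆X Y∈ with ∈-map⁻ representative Y∈
    ... | v , _ , refl = representative⊆X v

    representatives-cover : ∀ {Y} → Y ⊆ X →
      ∃ λ Y′ → Y′ ∈ˡ representatives × (∀ I → I ⊆ ∁ X → MinorIndep M Y I ⇔ MinorIndep M Y′ I)
    representatives-cover {Y} Y⊆X =
      representative (profile Y) , ∈-map⁺ representative (profile∈profiles Y⊆X) ,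
      sameProfile⇒sameMinor Y⊆X (representative⊆X (profile Y)) (sym (profile-representative Y⊆X))

theorem4p7 : ∀ {n} (M : Matroid n) → IsNested M →
    ∀ (i : ℕ) → i ≤ n →
    ∀ (a b c : ℕ) →
    IsRank M (Epref n i) a → IsRank M (∁ (Epref n i)) b → IsRank M ⊤ c →
    MinorCountAtMost M i (2 ^ (a + b ∸ c))
-- Only X = E_i as a subset of E matters.
theorem4p7 {n} M nested i _ a b c rank-a rank-b rank-c with nested⇒levelMatroid M nested
... | m , lv , indep⇔ =
  representatives X , length-representatives≤ X rank-a rank-b rank-c ,
  (λ _ → ∈representatives⇒⊆X X) , (λ _ → representatives-cover X)
  where
  open LevelMatroidMinors M m lv indep⇔
  X = Epref n i
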